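{- For $1\le k\le n$, let $T_{n,k}$ be the set of integer sequences $e=(e_1,\dots,e_n)$ with $0\le e_i<i$ for all $i\in[n]$ such that there are no indices $i<j<k'$ with $e_i\ne e_j=e_{k'}$, and such that $|\{e_1,\dots,e_n\}|=k$. Then $|T_{n,k}|=(n+1-k)^k-(n-k)^k$. -}

module Defs where

open import Data.Nat using (ℕ; zero; suc; _<_)
open import Data.Nat.Properties using (_≟_)
open import Data.Fin using (Fin; toℕ) renaming (_<_ to _<ᶠ_)
open import Data.Fin.Properties using (any?) renaming (_<?_ to _<ᶠ?_)
open import Data.List using (List; []; _∷_; map; concatMap; upTo; filter; deduplicate; length)
open import Data.Vec using (Vec; []; _∷ʳ_; lookup; toList)
open import Data.Product using (Σ; ∃; _×_; _,_)
open import Relation.Binary.PropositionalEquality using (_≡_; _≢_)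
open import Relation.Nullary using (¬_; Dec; ¬?)
open import Relation.Nullary.Decidable using (_×-dec_)

-- Sequences are Vec ℕ n, indexed 0-based by Fin n: position i : Fin n is the
-- paper's index (toℕ i + 1).  The inversion-sequence condition 0 ≤ e_i < i
-- (1-based) reads  lookup e i < suc (toℕ i).

invSeqs : (n : ℕ) → List (Vec ℕ n)
invSeqs zero    = [] ∷ []
invSeqs (suc n) = concatMap (λ e → map (λ x → e ∷ʳ x) (upTo (suc n))) (invSeqs n)

HasPattern : {n : ℕ} → Vec ℕ n → Set
HasPattern {n} e =
  ∃ λ (i : Fin n) → ∃ λ (j : Fin n) → ∃ λ (l : Fin n) →
    (i <ᶠ j) × (j <ᶠ l) × (lookup e i ≢ lookup e j) × (lookup e j ≡ lookup e l)

hasPattern? : {n : ℕ} → (e : Vec ℕ n) → Dec (HasPattern e)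
hasPattern? e =
  any? λ i → any? λ j → any? λ l →
    (i <ᶠ? j) ×-dec ((j <ᶠ? l) ×-dec (¬? (lookup e i ≟ lookup e j) ×-dec (lookup e j ≟ lookup e l)))

numDistinct : {n : ℕ} → Vec ℕ n → ℕ
numDistinct e = length (deduplicate _≟_ (toList e))

InT : (n k : ℕ) → Vec ℕ n → Set
InT n k e = (¬ HasPattern e) × (numDistinct e ≡ k)

inT? : (n k : ℕ) → (e : Vec ℕ n) → Dec (InT n k e)
inT? n k e = ¬? (hasPattern? e) ×-dec (numDistinct e ≟ k)

T : (n k : ℕ) → List (Vec ℕ n)
T n k = filter (inT? n k) (invSeqs n)

-- An inversion sequence e starts with 0, so appending a positive value v creates the
-- pattern exactly when v already occurs in e (the leading 0 and that occurrence precede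
-- it), while a fresh v adds one distinct value and no pattern.  Appending 0 keeps the
-- values and avoids the pattern iff no 0 of e follows a nonzero entry; call the
-- pattern-free such e with k values S(n,k).  As e has n+1-k fresh values, all positive,
--   |T(n+1,k+1)| = (n+1-k) |T(n,k)| + |S(n,k+1)|,   |S(n+1,k+1)| = (n+1-k) |S(n,k)| + [k = 0],
-- so |S(n,k)| = (n+1-k)^(k-1), and the formula follows by induction from
--   a^(k+1) - (a-1)^(k+1) = a (a^k - (a-1)^k) + (a-1)^k.
module Submission where

open import Data.Nat using (ℕ; zero; suc; _+_; _*_; _∸_; _^_; _<_; _≤_; z<s)
open import Data.Nat.Properties
open import Data.Nat.Tactic.RingSolver using (solve-∀)
open import Data.Fin using (Fin; zero; suc; toℕ; inject₁; fromℕ) renaming (_<_ to _<ᶠ_)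
open import Data.Fin.Properties using (toℕ-inject₁; toℕ-fromℕ; toℕ<n; ≤fromℕ; any?; all?) renaming (_<?_ to _<ᶠ?_)
open import Data.Fin.Relation.Unary.Top using (view; ‵fromℕ; ‵inject₁)
open import Data.List using (List; []; _∷_; _++_; [_]; map; filter; length; upTo; applyUpTo; concatMap; deduplicate)
open import Data.List.Properties using (filter-≐; filter-none; filter-++; length-++; map-upTo; length-upTo)
open import Data.List.Membership.Propositional using (_∈_; _∉_)
open import Data.List.Membership.Propositional.Properties
  using (∈-filter⁺; ∈-filter⁻; ∈-upTo⁺; ∈-++⁺ˡ; ∈-++⁻; ∈-deduplicate⁺; ∈-deduplicate⁻)
open import Data.List.Membership.Propositional.Properties.WithK using (unique∧set⇒bag)
open import Data.List.Membership.DecPropositional _≟_ using (_∈?_)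
open import Data.List.Relation.Unary.Any using (here)
open import Data.List.Relation.Unary.All as All using (All; []; _∷_)
open import Data.List.Relation.Unary.All.Properties using (concat⁺; map⁺; applyUpTo⁺₁)
open import Data.List.Relation.Unary.Unique.Propositional using (Unique; []; _∷_)
open import Data.List.Relation.Unary.Unique.Propositional.Properties using (filter⁺; upTo⁺)
open import Data.List.Relation.Unary.Unique.DecPropositional.Properties _≟_ using (deduplicate-!)
open import Data.List.Relation.Binary.BagAndSetEquality using (_∼[_]_; set; ∼bag⇒↭)
open import Data.List.Relation.Binary.Permutation.Propositional.Properties using (↭-length)
open import Data.List.Relation.Binary.Permutation.Propositional.Properties.WithK using (dedup-++-↭)
open import Data.Vec using (Vec; _∷ʳ_; lookup; toList) renaming ([] to []ᵥ; _∷_ to _∷ᵥ_)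
open import Data.Vec.Properties using (toList-∷ʳ)
open import Data.Vec.Membership.Propositional.Properties using (∈-lookup; ∈-toList⁺; ∈-toList⁻)
open import Data.Vec.Relation.Unary.Any using (index)
open import Data.Vec.Relation.Unary.Any.Properties using (lookup-index)
import Data.Vec.Relation.Unary.All.Properties as Vecᴬ
open import Data.Product using (∃; _×_; _,_; proj₁; proj₂)
open import Data.Sum using (_⊎_; inj₁; inj₂; [_,_]′)
open import Function using (_∘_; _$_; id; _⇔_; mk⇔; Equivalence)
open import Level using (0ℓ)
open import Relation.Binary.PropositionalEquality
  using (_≡_; _≢_; refl; sym; trans; cong; cong₂; subst; subst₂; module ≡-Reasoning)
open import Relation.Nullary using (¬_; Dec; yes; no; ¬?; contradiction; _¬-⊎_)
open import Relation.Nullary.Decidable using (_×-dec_; decidable-stable)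
open import Relation.Unary using (Pred; Decidable; _≐_)

open import Defs

open Equivalence using (to; from)

private variable
  A B : Set
  m : ℕ

-- Counting

indicator : {P : Set} → Dec P → ℕ
indicator (yes _) = 1
indicator (no _)  = 0

indicator-cong : {P Q : Set} (P? : Dec P) (Q? : Dec Q) → (P → Q) → (Q → P) → indicator P? ≡ indicator Q?
indicator-cong (yes _) (yes _) _ _ = refl
indicator-cong (yes p) (no ¬q) f _ = contradiction (f p) ¬q
indicator-cong (no ¬p) (yes q) _ g = contradiction (g q) ¬p
indicator-cong (no _)  (no _)  _ _ = refl

count : {P : Pred A 0ℓ} → Decidable P → List A → ℕ
count P? xs = length (filter P? xs)

count-∷ : {P : Pred A 0ℓ} (P? : Decidable P) → ∀ x xs → count P? (x ∷ xs) ≡ indicator (P? x) + count P? xs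
count-∷ P? x xs with P? x
... | yes _ = refl
... | no _  = refl

module _ {P : Pred A 0ℓ} (P? : Decidable P) where

  count-none : ∀ {xs} → All (¬_ ∘ P) xs → count P? xs ≡ 0
  count-none ¬ps = cong length (filter-none P? ¬ps)

  count-++ : ∀ xs ys → count P? (xs ++ ys) ≡ count P? xs + count P? ys
  count-++ xs ys = trans (cong length (filter-++ P? xs ys)) (length-++ (filter P? xs))

  count-map : (f : B → A) (xs : List B) → count P? (map f xs) ≡ count (P? ∘ f) xs
  count-map f []       = refl
  count-map f (x ∷ xs) = begin
    count P? (f x ∷ map f xs)                  ≡⟨ count-∷ P? (f x) (map f xs) ⟩
    indicator (P? (f x)) + count P? (map f xs) ≡⟨ cong (indicator (P? (f x)) +_) (count-map f xs) ⟩
    indicator (P? (f x)) + count (P? ∘ f) xs   ≡⟨ count-∷ (P? ∘ f) x xs ⟨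
    count (P? ∘ f) (x ∷ xs)                    ∎
    where open ≡-Reasoning

  count-complement : ∀ xs → count P? xs + count (¬? ∘ P?) xs ≡ length xs
  count-complement []       = refl
  count-complement (x ∷ xs) with P? x
  ... | yes _ = cong suc (count-complement xs)
  ... | no _  = trans (+-suc _ _) (cong suc (count-complement xs))

count-≐ : {P Q : Pred A 0ℓ} (P? : Decidable P) (Q? : Decidable Q) → P ≐ Q → ∀ xs → count P? xs ≡ count Q? xs
count-≐ P? Q? P≐Q xs = cong length (filter-≐ P? Q? P≐Q xs)

count-upTo-suc : {P : Pred ℕ 0ℓ} (P? : Decidable P) → ∀ n →
  count P? (upTo (suc n)) ≡ indicator (P? 0) + count (P? ∘ suc) (upTo n)
count-upTo-suc P? n = begin
  count P? (0 ∷ applyUpTo suc n)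
    ≡⟨ count-∷ P? 0 (applyUpTo suc n) ⟩
  indicator (P? 0) + count P? (applyUpTo suc n)
    ≡⟨ cong (λ ys → indicator (P? 0) + count P? ys) (map-upTo suc n) ⟨
  indicator (P? 0) + count P? (map suc (upTo n))
    ≡⟨ cong (indicator (P? 0) +_) (count-map P? suc (upTo n)) ⟩
  indicator (P? 0) + count (P? ∘ suc) (upTo n)
    ∎
  where open ≡-Reasoning

count-concatMap : {P : Pred A 0ℓ} {X Y : Pred B 0ℓ} (P? : Decidable P) (X? : Decidable X) (Y? : Decidable Y)
  (f : B → List A) (c : ℕ) {xs : List B} →
  All (λ x → count P? (f x) ≡ c * indicator (X? x) + indicator (Y? x)) xs →
  count P? (concatMap f xs) ≡ c * count X? xs + count Y? xs
count-concatMap P? X? Y? f c []  = sym (cong (_+ 0) (*-zeroʳ c))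
count-concatMap P? X? Y? f c {x ∷ xs} (eq ∷ eqs) = begin
  count P? (f x ++ concatMap f xs)
    ≡⟨ count-++ P? (f x) (concatMap f xs) ⟩
  count P? (f x) + count P? (concatMap f xs)
    ≡⟨ cong₂ _+_ eq (count-concatMap P? X? Y? f c eqs) ⟩
  (c * indicator (X? x) + indicator (Y? x)) + (c * count X? xs + count Y? xs)
    ≡⟨ regroup c (indicator (X? x)) (indicator (Y? x)) (count X? xs) (count Y? xs) ⟩
  c * (indicator (X? x) + count X? xs) + (indicator (Y? x) + count Y? xs)
    ≡⟨ cong₂ (λ a b → c * a + b) (count-∷ X? x xs) (count-∷ Y? x xs) ⟨
  c * count X? (x ∷ xs) + count Y? (x ∷ xs)
    ∎
  where
  open ≡-Reasoning
  regroup : ∀ c a b u v → (c * a + b) + (c * u + v) ≡ c * (a + u) + (b + v)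
  regroup = solve-∀

-- Distinct entries

length-unique-set : {xs ys : List A} → Unique xs → Unique ys → xs ∼[ set ] ys → length xs ≡ length ys
length-unique-set xs! ys! xs∼ys = ↭-length (∼bag⇒↭ (unique∧set⇒bag xs! ys! xs∼ys))

dedup : List ℕ → List ℕ
dedup = deduplicate _≟_

length-dedup-∷ʳ-∈ : ∀ {x xs} → x ∈ xs → length (dedup (xs ++ [ x ])) ≡ length (dedup xs)
length-dedup-∷ʳ-∈ {x} {xs} x∈xs =
  length-unique-set (deduplicate-! _) (deduplicate-! _) (mk⇔ forth back)
  where
  forth : ∀ {z} → z ∈ dedup (xs ++ [ x ]) → z ∈ dedup xs
  forth z∈ with ∈-++⁻ xs (∈-deduplicate⁻ _≟_ (xs ++ [ x ]) z∈)
  ... | inj₁ z∈xs        = ∈-deduplicate⁺ _≟_ z∈xs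
  ... | inj₂ (here refl) = ∈-deduplicate⁺ _≟_ x∈xs
  back : ∀ {z} → z ∈ dedup xs → z ∈ dedup (xs ++ [ x ])
  back z∈ = ∈-deduplicate⁺ _≟_ (∈-++⁺ˡ (∈-deduplicate⁻ _≟_ xs z∈))

length-dedup-∷ʳ-∉ : ∀ {x xs} → x ∉ xs → length (dedup (xs ++ [ x ])) ≡ suc (length (dedup xs))
length-dedup-∷ʳ-∉ {x} {xs} x∉xs = begin
  length (dedup (xs ++ [ x ])) ≡⟨ ↭-length (dedup-++-↭ _≟_ disjoint) ⟩
  length (dedup xs ++ [ x ])   ≡⟨ length-++ (dedup xs) ⟩
  length (dedup xs) + 1        ≡⟨ +-comm _ 1 ⟩
  suc (length (dedup xs))      ∎
  where
  open ≡-Reasoning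
  disjoint : ∀ {v} → ¬ (v ∈ xs × v ∈ [ x ])
  disjoint (v∈xs , here refl) = x∉xs v∈xs

length-dedup≡count : ∀ {B xs} → All (_< B) xs → length (dedup xs) ≡ count (_∈? xs) (upTo B)
length-dedup≡count {B} {xs} xs<B =
  length-unique-set (deduplicate-! xs) (filter⁺ (_∈? xs) (upTo⁺ B)) (mk⇔ forth back)
  where
  forth : ∀ {z} → z ∈ dedup xs → z ∈ filter (_∈? xs) (upTo B)
  forth z∈ = let z∈xs = ∈-deduplicate⁻ _≟_ xs z∈ in
    ∈-filter⁺ (_∈? xs) (∈-upTo⁺ (All.lookup xs<B z∈xs)) z∈xs
  back : ∀ {z} → z ∈ filter (_∈? xs) (upTo B) → z ∈ dedup xs
  back z∈ = ∈-deduplicate⁺ _≟_ (proj₂ (∈-filter⁻ (_∈? xs) {xs = upTo B} z∈))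

count-∉≡∸length-dedup : ∀ {B xs} → All (_< B) xs → count (¬? ∘ (_∈? xs)) (upTo B) ≡ B ∸ length (dedup xs)
count-∉≡∸length-dedup {B} {xs} xs<B = begin
  count∉
    ≡⟨ m+n∸m≡n count∈ count∉ ⟨
  count∈ + count∉ ∸ count∈
    ≡⟨ cong₂ _∸_ (trans (count-complement (_∈? xs) (upTo B)) (length-upTo B)) (sym (length-dedup≡count xs<B)) ⟩
  B ∸ length (dedup xs)
    ∎
  where
  open ≡-Reasoning
  count∈ count∉ : ℕ
  count∈ = count (_∈? xs) (upTo B)
  count∉ = count (¬? ∘ (_∈? xs)) (upTo B)

-- Appending an entry

lookup-∷ʳ-inject₁ : (e : Vec A m) (x : A) (i : Fin m) → lookup (e ∷ʳ x) (inject₁ i) ≡ lookup e i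
lookup-∷ʳ-inject₁ (a ∷ᵥ e) x zero    = refl
lookup-∷ʳ-inject₁ (a ∷ᵥ e) x (suc i) = lookup-∷ʳ-inject₁ e x i

lookup-∷ʳ-fromℕ : (e : Vec A m) (x : A) → lookup (e ∷ʳ x) (fromℕ m) ≡ x
lookup-∷ʳ-fromℕ []ᵥ       x = refl
lookup-∷ʳ-fromℕ (a ∷ᵥ e) x = lookup-∷ʳ-fromℕ e x

inject₁-<⁺ : {i j : Fin m} → i <ᶠ j → inject₁ i <ᶠ inject₁ j
inject₁-<⁺ {i = i} {j} = subst₂ _<_ (sym (toℕ-inject₁ i)) (sym (toℕ-inject₁ j))

inject₁-<⁻ : {i j : Fin m} → inject₁ i <ᶠ inject₁ j → i <ᶠ j
inject₁-<⁻ {i = i} {j} = subst₂ _<_ (toℕ-inject₁ i) (toℕ-inject₁ j)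

inject₁<fromℕ : (i : Fin m) → inject₁ i <ᶠ fromℕ m
inject₁<fromℕ {m} i = subst₂ _<_ (sym (toℕ-inject₁ i)) (sym (toℕ-fromℕ m)) (toℕ<n i)

fromℕ≮ : (i : Fin (suc m)) → ¬ (fromℕ m <ᶠ i)
fromℕ≮ i lt = <⇒≱ lt (≤fromℕ i)

CompletesPattern : Vec ℕ m → ℕ → Set
CompletesPattern {m} e y =
  ∃ λ (i : Fin m) → ∃ λ (j : Fin m) → (i <ᶠ j) × (lookup e i ≢ lookup e j) × (lookup e j ≡ y)

completesPattern? : (e : Vec ℕ m) (y : ℕ) → Dec (CompletesPattern e y)
completesPattern? e y =
  any? λ i → any? λ j → (i <ᶠ? j) ×-dec (¬? (lookup e i ≟ lookup e j) ×-dec (lookup e j ≟ y))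

module _ (e : Vec ℕ m) (x : ℕ) where

  private
    ↑ : ∀ i → lookup (e ∷ʳ x) (inject₁ i) ≡ lookup e i
    ↑ = lookup-∷ʳ-inject₁ e x

  hasPattern-∷ʳ⁺ : HasPattern e ⊎ CompletesPattern e x → HasPattern (e ∷ʳ x)
  hasPattern-∷ʳ⁺ (inj₁ (i , j , l , i<j , j<l , eᵢ≢eⱼ , eⱼ≡eₗ)) =
    inject₁ i , inject₁ j , inject₁ l , inject₁-<⁺ i<j , inject₁-<⁺ j<l ,
    subst₂ _≢_ (sym (↑ i)) (sym (↑ j)) eᵢ≢eⱼ , subst₂ _≡_ (sym (↑ j)) (sym (↑ l)) eⱼ≡eₗ
  hasPattern-∷ʳ⁺ (inj₂ (i , j , i<j , eᵢ≢eⱼ , eⱼ≡x)) =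
    inject₁ i , inject₁ j , fromℕ m , inject₁-<⁺ i<j , inject₁<fromℕ j ,
    subst₂ _≢_ (sym (↑ i)) (sym (↑ j)) eᵢ≢eⱼ , subst₂ _≡_ (sym (↑ j)) (sym (lookup-∷ʳ-fromℕ e x)) eⱼ≡x

  hasPattern-∷ʳ⁻ : HasPattern (e ∷ʳ x) → HasPattern e ⊎ CompletesPattern e x
  hasPattern-∷ʳ⁻ (i , j , l , i<j , j<l , eᵢ≢eⱼ , eⱼ≡eₗ) with view i | view j | view l
  ... | ‵fromℕ | _ | _ = contradiction i<j (fromℕ≮ j)
  ... | ‵inject₁ i' | ‵fromℕ | _ = contradiction j<l (fromℕ≮ l)
  ... | ‵inject₁ i' | ‵inject₁ j' | ‵inject₁ l' =
    inj₁ (i' , j' , l' , inject₁-<⁻ i<j , inject₁-<⁻ j<l ,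
          subst₂ _≢_ (↑ i') (↑ j') eᵢ≢eⱼ , subst₂ _≡_ (↑ j') (↑ l') eⱼ≡eₗ)
  ... | ‵inject₁ i' | ‵inject₁ j' | ‵fromℕ =
    inj₂ (i' , j' , inject₁-<⁻ i<j , subst₂ _≢_ (↑ i') (↑ j') eᵢ≢eⱼ ,
          subst₂ _≡_ (↑ j') (lookup-∷ʳ-fromℕ e x) eⱼ≡eₗ)

  patternFree-∷ʳ : (¬ HasPattern (e ∷ʳ x)) ⇔ (¬ HasPattern e × ¬ CompletesPattern e x)
  patternFree-∷ʳ = mk⇔ (λ ¬p → ¬p ∘ hasPattern-∷ʳ⁺ ∘ inj₁ , ¬p ∘ hasPattern-∷ʳ⁺ ∘ inj₂)
                       (λ (¬p , ¬c) → (¬p ¬-⊎ ¬c) ∘ hasPattern-∷ʳ⁻)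

  completesPattern-∷ʳ⁺ : ∀ {y} → CompletesPattern e y ⊎ (x ≡ y × ∃ λ i → lookup e i ≢ x) →
                         CompletesPattern (e ∷ʳ x) y
  completesPattern-∷ʳ⁺ (inj₁ (i , j , i<j , eᵢ≢eⱼ , eⱼ≡y)) =
    inject₁ i , inject₁ j , inject₁-<⁺ i<j , subst₂ _≢_ (sym (↑ i)) (sym (↑ j)) eᵢ≢eⱼ , trans (↑ j) eⱼ≡y
  completesPattern-∷ʳ⁺ (inj₂ (refl , i , eᵢ≢x)) =
    inject₁ i , fromℕ m , inject₁<fromℕ i ,
    subst₂ _≢_ (sym (↑ i)) (sym (lookup-∷ʳ-fromℕ e x)) eᵢ≢x , lookup-∷ʳ-fromℕ e x

  completesPattern-∷ʳ⁻ : ∀ {y} → CompletesPattern (e ∷ʳ x) y →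
                         CompletesPattern e y ⊎ (x ≡ y × ∃ λ i → lookup e i ≢ x)
  completesPattern-∷ʳ⁻ (i , j , i<j , eᵢ≢eⱼ , eⱼ≡y) with view i | view j
  ... | ‵fromℕ | _ = contradiction i<j (fromℕ≮ j)
  ... | ‵inject₁ i' | ‵inject₁ j' =
    inj₁ (i' , j' , inject₁-<⁻ i<j , subst₂ _≢_ (↑ i') (↑ j') eᵢ≢eⱼ , trans (sym (↑ j')) eⱼ≡y)
  ... | ‵inject₁ i' | ‵fromℕ =
    inj₂ (trans (sym (lookup-∷ʳ-fromℕ e x)) eⱼ≡y , i' , subst₂ _≢_ (↑ i') (lookup-∷ʳ-fromℕ e x) eᵢ≢eⱼ)

numDistinct-∷ʳ-∈ : (e : Vec ℕ m) {x : ℕ} → x ∈ toList e → numDistinct (e ∷ʳ x) ≡ numDistinct e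
numDistinct-∷ʳ-∈ e {x} x∈e = trans (cong (length ∘ dedup) (toList-∷ʳ x e)) (length-dedup-∷ʳ-∈ x∈e)

numDistinct-∷ʳ-∉ : (e : Vec ℕ m) {x : ℕ} → x ∉ toList e → numDistinct (e ∷ʳ x) ≡ suc (numDistinct e)
numDistinct-∷ʳ-∉ e {x} x∉e = trans (cong (length ∘ dedup) (toList-∷ʳ x e)) (length-dedup-∷ʳ-∉ x∉e)

completesPattern⇒∈ : (e : Vec ℕ m) {y : ℕ} → CompletesPattern e y → y ∈ toList e
completesPattern⇒∈ e (_ , j , _ , _ , refl) = ∈-toList⁺ (∈-lookup j e)

-- Inversion sequences

IsInversionSequence : Vec ℕ m → Set
IsInversionSequence {m} e = ∀ (i : Fin m) → lookup e i ≤ toℕ i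

isInversionSequence-∷ʳ : (e : Vec ℕ m) → IsInversionSequence e →
                         ∀ {x} → x ≤ m → IsInversionSequence (e ∷ʳ x)
isInversionSequence-∷ʳ {m} e inv {x} x≤m a with view a
... | ‵fromℕ     = subst₂ _≤_ (sym (lookup-∷ʳ-fromℕ e x)) (sym (toℕ-fromℕ m)) x≤m
... | ‵inject₁ i = subst₂ _≤_ (sym (lookup-∷ʳ-inject₁ e x i)) (sym (toℕ-inject₁ i)) (inv i)

extensions : Vec ℕ m → List (Vec ℕ (suc m))
extensions {m} e = map (e ∷ʳ_) (upTo (suc m))

invSeqs-isInversionSequence : ∀ n → All IsInversionSequence (invSeqs n)
invSeqs-isInversionSequence zero    = (λ ()) ∷ []
invSeqs-isInversionSequence (suc n) =
  concat⁺ (map⁺ (All.map extensions-inv (invSeqs-isInversionSequence n)))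
  where
  extensions-inv : ∀ {e} → IsInversionSequence e → All IsInversionSequence (extensions e)
  extensions-inv {e} inv =
    map⁺ (applyUpTo⁺₁ id (suc n) (λ x<1+n → isInversionSequence-∷ʳ e inv (≤-pred x<1+n)))

entries<length : (e : Vec ℕ m) → IsInversionSequence e → All (_< m) (toList e)
entries<length e inv = Vecᴬ.toList⁺ (Vecᴬ.lookup⁻ λ i → ≤-<-trans (inv i) (toℕ<n i))

module _ {m : ℕ} (e : Vec ℕ (suc m)) (inv : IsInversionSequence e) where

  head≡0 : lookup e zero ≡ 0
  head≡0 = n≤0⇒n≡0 (inv zero)

  0∈ : 0 ∈ toList e
  0∈ = subst (_∈ toList e) head≡0 (∈-toList⁺ (∈-lookup zero e))

  ∈⇒completesPattern : ∀ {y} → y ≢ 0 → y ∈ toList e → CompletesPattern e y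
  ∈⇒completesPattern {y} y≢0 y∈e with index (∈-toList⁻ y∈e) | lookup-index (∈-toList⁻ y∈e)
  ... | zero  | y≡e₀ = contradiction (trans y≡e₀ head≡0) y≢0
  ... | suc j | y≡eⱼ =
    zero , suc j , z<s , (λ e₀≡eⱼ → y≢0 (trans y≡eⱼ (trans (sym e₀≡eⱼ) head≡0))) , sym y≡eⱼ

  count-fresh-positive : count (λ y → ¬? (suc y ∈? toList e)) (upTo (suc m)) ≡ suc (suc m) ∸ numDistinct e
  count-fresh-positive = begin
    count (λ y → ¬? (suc y ∈? toList e)) (upTo (suc m))
      ≡⟨ cong (_+ count (λ y → ¬? (suc y ∈? toList e)) (upTo (suc m))) 0∉-indicator ⟨
    indicator (¬? (0 ∈? toList e)) + count (λ y → ¬? (suc y ∈? toList e)) (upTo (suc m))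
      ≡⟨ count-upTo-suc (¬? ∘ (_∈? toList e)) (suc m) ⟨
    count (¬? ∘ (_∈? toList e)) (upTo (suc (suc m)))
      ≡⟨ count-∉≡∸length-dedup (All.map m<n⇒m<1+n (entries<length e inv)) ⟩
    suc (suc m) ∸ numDistinct e
      ∎
    where
    open ≡-Reasoning
    0∉-indicator : indicator (¬? (0 ∈? toList e)) ≡ 0
    0∉-indicator = indicator-cong (¬? (0 ∈? toList e)) (no id) (_$ 0∈) λ ()

-- ¬ CompletesPattern e 0 says that no 0 of e follows a nonzero entry.
InS : (n k : ℕ) → Vec ℕ n → Set
InS n k e = ¬ HasPattern e × ¬ CompletesPattern e 0 × numDistinct e ≡ k

inS? : (n k : ℕ) → (e : Vec ℕ n) → Dec (InS n k e)
inS? n k e = ¬? (hasPattern? e) ×-dec (¬? (completesPattern? e 0) ×-dec (numDistinct e ≟ k))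

S : (n k : ℕ) → List (Vec ℕ n)
S n k = filter (inS? n k) (invSeqs n)

AllZero : Vec ℕ m → Set
AllZero e = ∀ i → lookup e i ≡ 0

allZero? : (e : Vec ℕ m) → Dec (AllZero e)
allZero? e = all? λ i → lookup e i ≟ 0

module _ (e : Vec ℕ m) (zeros : AllZero e) where

  allZero⇒patternFree : ¬ HasPattern e
  allZero⇒patternFree (i , j , _ , _ , _ , eᵢ≢eⱼ , _) = eᵢ≢eⱼ (trans (zeros i) (sym (zeros j)))

  allZero⇒¬completesPattern : ∀ {y} → ¬ CompletesPattern e y
  allZero⇒¬completesPattern (i , j , _ , eᵢ≢eⱼ , _) = eᵢ≢eⱼ (trans (zeros i) (sym (zeros j)))

  allZero-∷ʳ : AllZero (e ∷ʳ 0)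
  allZero-∷ʳ a with view a
  ... | ‵fromℕ     = lookup-∷ʳ-fromℕ e 0
  ... | ‵inject₁ i = trans (lookup-∷ʳ-inject₁ e 0 i) (zeros i)

allZero-∷ʳ⁻ : (e : Vec ℕ m) (x : ℕ) → AllZero (e ∷ʳ x) → AllZero e × x ≡ 0
allZero-∷ʳ⁻ {m} e x zeros =
  (λ i → trans (sym (lookup-∷ʳ-inject₁ e x i)) (zeros (inject₁ i))) ,
  trans (sym (lookup-∷ʳ-fromℕ e x)) (zeros (fromℕ m))

numDistinct-allZero : (e : Vec ℕ (suc m)) → AllZero e → numDistinct e ≡ 1
numDistinct-allZero e zeros =
  length-unique-set (deduplicate-! (toList e)) ([] ∷ []) (mk⇔ forth back)
  where
  forth : ∀ {z} → z ∈ dedup (toList e) → z ∈ [ 0 ]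
  forth z∈ with lookup-index (∈-toList⁻ (∈-deduplicate⁻ _≟_ (toList e) z∈))
  ... | z≡eᵢ = here (trans z≡eᵢ (zeros _))
  back : ∀ {z} → z ∈ [ 0 ] → z ∈ dedup (toList e)
  back (here refl) = ∈-deduplicate⁺ _≟_ (subst (_∈ toList e) (zeros zero) (∈-toList⁺ (∈-lookup zero e)))

module _ {m : ℕ} (e : Vec ℕ (suc m)) (inv : IsInversionSequence e) where

  private
    ¬completesPattern⇔∉ : ∀ y → (¬ CompletesPattern e (suc y)) ⇔ (suc y ∉ toList e)
    ¬completesPattern⇔∉ y = mk⇔ (λ ¬c → ¬c ∘ ∈⇒completesPattern e inv λ ()) (λ y∉ → y∉ ∘ completesPattern⇒∈ e)

  patternFree-∷ʳ-positive : ∀ y → (¬ HasPattern (e ∷ʳ suc y)) ⇔ (¬ HasPattern e × suc y ∉ toList e)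
  patternFree-∷ʳ-positive y = mk⇔
    (λ ¬p → let (¬pₑ , ¬c) = to (patternFree-∷ʳ e (suc y)) ¬p in ¬pₑ , to (¬completesPattern⇔∉ y) ¬c)
    (λ (¬pₑ , y∉) → from (patternFree-∷ʳ e (suc y)) (¬pₑ , from (¬completesPattern⇔∉ y) y∉))

  count-extensions : {Q : Pred (Vec ℕ (suc (suc m))) 0ℓ} (Q? : Decidable Q) {D : Set} (D? : Dec D) {k : ℕ} →
    (D → numDistinct e ≡ k) → (∀ y → Q (e ∷ʳ suc y) ⇔ (D × suc y ∉ toList e)) →
    count Q? (extensions e) ≡ (suc (suc m) ∸ k) * indicator D? + indicator (Q? (e ∷ʳ 0))
  count-extensions {Q} Q? {D} D? {k} distinct Q⇔ = begin
    count Q? (extensions e)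
      ≡⟨ count-map Q? (e ∷ʳ_) (upTo (suc (suc m))) ⟩
    count (Q? ∘ (e ∷ʳ_)) (upTo (suc (suc m)))
      ≡⟨ count-upTo-suc (Q? ∘ (e ∷ʳ_)) (suc m) ⟩
    indicator (Q? (e ∷ʳ 0)) + count (λ y → Q? (e ∷ʳ suc y)) (upTo (suc m))
      ≡⟨ +-comm (indicator (Q? (e ∷ʳ 0))) _ ⟩
    count (λ y → Q? (e ∷ʳ suc y)) (upTo (suc m)) + indicator (Q? (e ∷ʳ 0))
      ≡⟨ cong (_+ indicator (Q? (e ∷ʳ 0))) (positive D?) ⟩
    (suc (suc m) ∸ k) * indicator D? + indicator (Q? (e ∷ʳ 0))
      ∎
    where
    open ≡-Reasoning
    positive : (D? : Dec D) → count (λ y → Q? (e ∷ʳ suc y)) (upTo (suc m)) ≡ (suc (suc m) ∸ k) * indicator D?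
    positive (yes d) = begin
      count (λ y → Q? (e ∷ʳ suc y)) (upTo (suc m))
        ≡⟨ count-≐ (λ y → Q? (e ∷ʳ suc y)) (λ y → ¬? (suc y ∈? toList e))
                   (proj₂ ∘ to (Q⇔ _) , λ y∉ → from (Q⇔ _) (d , y∉)) (upTo (suc m)) ⟩
      count (λ y → ¬? (suc y ∈? toList e)) (upTo (suc m))
        ≡⟨ count-fresh-positive e inv ⟩
      suc (suc m) ∸ numDistinct e
        ≡⟨ cong (suc (suc m) ∸_) (distinct d) ⟩
      suc (suc m) ∸ k
        ≡⟨ *-identityʳ _ ⟨
      (suc (suc m) ∸ k) * 1
        ∎
    positive (no ¬d) =
      trans (count-none (λ y → Q? (e ∷ʳ suc y)) (All.universal (λ _ → ¬d ∘ proj₁ ∘ to (Q⇔ _)) (upTo (suc m))))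
            (sym (*-zeroʳ (suc (suc m) ∸ k)))

  count-T-extensions : ∀ k → count (inT? (suc (suc m)) (suc k)) (extensions e)
    ≡ (suc (suc m) ∸ k) * indicator (inT? (suc m) k e) + indicator (inS? (suc m) (suc k) e)
  count-T-extensions k =
    trans (count-extensions (inT? (suc (suc m)) (suc k)) (inT? (suc m) k e) proj₂ positive)
          (cong ((suc (suc m) ∸ k) * indicator (inT? (suc m) k e) +_)
                (indicator-cong (inT? _ _ (e ∷ʳ 0)) (inS? _ _ e) zeroForth zeroBack))
    where
    positive : ∀ y → InT _ (suc k) (e ∷ʳ suc y) ⇔ (InT _ k e × suc y ∉ toList e)
    positive y = mk⇔
      (λ (¬p , distinct) → let (¬pₑ , y∉) = to (patternFree-∷ʳ-positive y) ¬p in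
        (¬pₑ , suc-injective (trans (sym (numDistinct-∷ʳ-∉ e y∉)) distinct)) , y∉)
      (λ ((¬pₑ , distinct) , y∉) →
        from (patternFree-∷ʳ-positive y) (¬pₑ , y∉) , trans (numDistinct-∷ʳ-∉ e y∉) (cong suc distinct))
    zeroForth : InT _ (suc k) (e ∷ʳ 0) → InS _ (suc k) e
    zeroForth (¬p , distinct) = let (¬pₑ , ¬c) = to (patternFree-∷ʳ e 0) ¬p in
      ¬pₑ , ¬c , trans (sym (numDistinct-∷ʳ-∈ e (0∈ e inv))) distinct
    zeroBack : InS _ (suc k) e → InT _ (suc k) (e ∷ʳ 0)
    zeroBack (¬pₑ , ¬c , distinct) =
      from (patternFree-∷ʳ e 0) (¬pₑ , ¬c) , trans (numDistinct-∷ʳ-∈ e (0∈ e inv)) distinct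

  count-S-extensions : ∀ k → count (inS? (suc (suc m)) (suc k)) (extensions e)
    ≡ (suc (suc m) ∸ k) * indicator (inS? (suc m) k e) + indicator (allZero? e ×-dec (k ≟ 0))
  count-S-extensions k =
    trans (count-extensions (inS? (suc (suc m)) (suc k)) (inS? (suc m) k e) (proj₂ ∘ proj₂) positive)
          (cong ((suc (suc m) ∸ k) * indicator (inS? (suc m) k e) +_)
                (indicator-cong (inS? _ _ (e ∷ʳ 0)) (allZero? e ×-dec (k ≟ 0)) zeroForth zeroBack))
    where
    ¬completesPattern-∷ʳ-positive : ∀ y → (¬ CompletesPattern (e ∷ʳ suc y) 0) ⇔ (¬ CompletesPattern e 0)
    ¬completesPattern-∷ʳ-positive y = mk⇔
      (λ ¬c → ¬c ∘ completesPattern-∷ʳ⁺ e (suc y) ∘ inj₁)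
      (λ ¬c → [ ¬c , 1+n≢0 ∘ proj₁ ]′ ∘ completesPattern-∷ʳ⁻ e (suc y))
    positive : ∀ y → InS _ (suc k) (e ∷ʳ suc y) ⇔ (InS _ k e × suc y ∉ toList e)
    positive y = mk⇔
      (λ (¬p , ¬c , distinct) → let (¬pₑ , y∉) = to (patternFree-∷ʳ-positive y) ¬p in
        (¬pₑ , to (¬completesPattern-∷ʳ-positive y) ¬c ,
         suc-injective (trans (sym (numDistinct-∷ʳ-∉ e y∉)) distinct)) , y∉)
      (λ ((¬pₑ , ¬c , distinct) , y∉) →
        from (patternFree-∷ʳ-positive y) (¬pₑ , y∉) , from (¬completesPattern-∷ʳ-positive y) ¬c ,
        trans (numDistinct-∷ʳ-∉ e y∉) (cong suc distinct))
    zeroForth : InS _ (suc k) (e ∷ʳ 0) → AllZero e × k ≡ 0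
    zeroForth (_ , ¬c , distinct) = zeros , suc-injective (begin
      suc k                 ≡⟨ distinct ⟨
      numDistinct (e ∷ʳ 0)  ≡⟨ numDistinct-∷ʳ-∈ e (0∈ e inv) ⟩
      numDistinct e         ≡⟨ numDistinct-allZero e zeros ⟩
      1                     ∎)
      where
      open ≡-Reasoning
      zeros : AllZero e
      zeros i = decidable-stable (lookup e i ≟ 0) λ eᵢ≢0 → ¬c (completesPattern-∷ʳ⁺ e 0 (inj₂ (refl , i , eᵢ≢0)))
    zeroBack : AllZero e × k ≡ 0 → InS _ (suc k) (e ∷ʳ 0)
    zeroBack (zeros , refl) =
      allZero⇒patternFree (e ∷ʳ 0) (allZero-∷ʳ e zeros) ,
      allZero⇒¬completesPattern (e ∷ʳ 0) (allZero-∷ʳ e zeros) ,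
      trans (numDistinct-∷ʳ-∈ e (0∈ e inv)) (numDistinct-allZero e zeros)

count-allZero-extensions : (e : Vec ℕ m) → count allZero? (extensions e) ≡ indicator (allZero? e)
count-allZero-extensions {m} e = begin
  count allZero? (extensions e)
    ≡⟨ count-map allZero? (e ∷ʳ_) (upTo (suc m)) ⟩
  count (allZero? ∘ (e ∷ʳ_)) (upTo (suc m))
    ≡⟨ count-upTo-suc (allZero? ∘ (e ∷ʳ_)) m ⟩
  indicator (allZero? (e ∷ʳ 0)) + count (λ y → allZero? (e ∷ʳ suc y)) (upTo m)
    ≡⟨ cong₂ _+_ (indicator-cong (allZero? (e ∷ʳ 0)) (allZero? e) (proj₁ ∘ allZero-∷ʳ⁻ e 0) (allZero-∷ʳ e))
                 (count-none (λ y → allZero? (e ∷ʳ suc y))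
                   (All.universal (λ y → 1+n≢0 ∘ proj₂ ∘ allZero-∷ʳ⁻ e (suc y)) (upTo m))) ⟩
  indicator (allZero? e) + 0
    ≡⟨ +-identityʳ _ ⟩
  indicator (allZero? e)
    ∎
  where open ≡-Reasoning

count-allZero : ∀ n → count allZero? (invSeqs n) ≡ 1
count-allZero zero    = refl
count-allZero (suc n) =
  trans (count-concatMap allZero? allZero? allZero? extensions 0
           (All.universal count-allZero-extensions (invSeqs n)))
        (count-allZero n)

-- Recurrences and closed forms

T-recurrence : ∀ m k →
  length (T (suc (suc m)) (suc k)) ≡ (suc (suc m) ∸ k) * length (T (suc m) k) + length (S (suc m) (suc k))
T-recurrence m k =
  count-concatMap (inT? _ (suc k)) (inT? (suc m) k) (inS? (suc m) (suc k)) extensions (suc (suc m) ∸ k)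
    (All.map (λ {e} inv → count-T-extensions e inv k) (invSeqs-isInversionSequence (suc m)))

S-recurrence : ∀ m k →
  length (S (suc (suc m)) (suc k)) ≡
  (suc (suc m) ∸ k) * length (S (suc m) k) + count (λ e → allZero? e ×-dec (k ≟ 0)) (invSeqs (suc m))
S-recurrence m k =
  count-concatMap (inS? _ (suc k)) (inS? (suc m) k) (λ e → allZero? e ×-dec (k ≟ 0)) extensions (suc (suc m) ∸ k)
    (All.map (λ {e} inv → count-S-extensions e inv k) (invSeqs-isInversionSequence (suc m)))

T-zero : ∀ m → length (T (suc m) 0) ≡ 0
T-zero m = count-none (inT? (suc m) 0) (All.universal (λ { (_ ∷ᵥ _) → 1+n≢0 ∘ proj₂ }) (invSeqs (suc m)))

S-zero : ∀ m → length (S (suc m) 0) ≡ 0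
S-zero m = count-none (inS? (suc m) 0) (All.universal (λ { (_ ∷ᵥ _) → 1+n≢0 ∘ proj₂ ∘ proj₂ }) (invSeqs (suc m)))

S-closed : ∀ m k → length (S (suc m) (suc k)) ≡ (suc m ∸ k) ^ k
S-closed zero    zero    = refl
S-closed zero    (suc k) rewrite 0∸n≡0 k = refl
S-closed (suc m) zero    = begin
  length (S (suc (suc m)) 1)
    ≡⟨ S-recurrence m 0 ⟩
  suc (suc m) * length (S (suc m) 0) + count (λ e → allZero? e ×-dec (0 ≟ 0)) (invSeqs (suc m))
    ≡⟨ cong₂ _+_ (trans (cong (suc (suc m) *_) (S-zero m)) (*-zeroʳ (suc (suc m))))
                 (count-≐ _ allZero? (proj₁ , (_, refl)) (invSeqs (suc m))) ⟩
  count allZero? (invSeqs (suc m))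
    ≡⟨ count-allZero (suc m) ⟩
  1 ∎
  where open ≡-Reasoning
S-closed (suc m) (suc k) = begin
  length (S (suc (suc m)) (suc (suc k)))
    ≡⟨ S-recurrence m (suc k) ⟩
  (suc m ∸ k) * length (S (suc m) (suc k)) + count (λ e → allZero? e ×-dec (suc k ≟ 0)) (invSeqs (suc m))
    ≡⟨ cong₂ _+_ (cong ((suc m ∸ k) *_) (S-closed m k))
                 (count-none _ (All.universal (λ _ → 1+n≢0 ∘ proj₂) (invSeqs (suc m)))) ⟩
  (suc m ∸ k) * (suc m ∸ k) ^ k + 0
    ≡⟨ +-identityʳ _ ⟩
  (suc m ∸ k) ^ suc k ∎
  where open ≡-Reasoning

pow-diff-step : ∀ b n → suc b * (suc b ^ n ∸ b ^ n) + b ^ n ≡ suc b ^ suc n ∸ b ^ suc n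
pow-diff-step b n = begin
  suc b * (suc b ^ n ∸ b ^ n) + b ^ n
    ≡⟨ m+n∸n≡m _ (b * b ^ n) ⟨
  suc b * (suc b ^ n ∸ b ^ n) + b ^ n + b * b ^ n ∸ b * b ^ n
    ≡⟨ cong (_∸ b * b ^ n) regroup ⟩
  suc b * (suc b ^ n ∸ b ^ n + b ^ n) ∸ b * b ^ n
    ≡⟨ cong (λ x → suc b * x ∸ b * b ^ n) (m∸n+n≡m (^-monoˡ-≤ n (n≤1+n b))) ⟩
  suc b ^ suc n ∸ b ^ suc n ∎
  where
  open ≡-Reasoning
  regroup : suc b * (suc b ^ n ∸ b ^ n) + b ^ n + b * b ^ n ≡ suc b * (suc b ^ n ∸ b ^ n + b ^ n)
  regroup = distrib b (suc b ^ n ∸ b ^ n) (b ^ n)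
    where
    distrib : ∀ b d y → suc b * d + y + b * y ≡ suc b * (d + y)
    distrib = solve-∀

T-closed : ∀ m k → length (T (suc m) (suc k)) ≡ (suc m ∸ k) ^ suc k ∸ (m ∸ k) ^ suc k
T-closed zero    zero    = refl
T-closed zero    (suc k) rewrite 0∸n≡0 k = refl
T-closed (suc m) zero    = begin
  length (T (suc (suc m)) 1)
    ≡⟨ T-recurrence m 0 ⟩
  suc (suc m) * length (T (suc m) 0) + length (S (suc m) 1)
    ≡⟨ cong₂ _+_ (trans (cong (suc (suc m) *_) (T-zero m)) (*-zeroʳ (suc (suc m)))) (S-closed m 0) ⟩
  1
    ≡⟨ m+n∸n≡m 1 (suc m) ⟨
  suc (suc m) ∸ suc m
    ≡⟨ cong₂ _∸_ (*-identityʳ (suc (suc m))) (*-identityʳ (suc m)) ⟨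
  suc (suc m) ^ 1 ∸ suc m ^ 1 ∎
  where open ≡-Reasoning
T-closed (suc m) (suc k) = begin
  length (T (suc (suc m)) (suc (suc k)))
    ≡⟨ T-recurrence m (suc k) ⟩
  (suc m ∸ k) * length (T (suc m) (suc k)) + length (S (suc m) (suc (suc k)))
    ≡⟨ cong₂ _+_ (cong ((suc m ∸ k) *_) (T-closed m k)) (S-closed m (suc k)) ⟩
  (suc m ∸ k) * ((suc m ∸ k) ^ suc k ∸ (m ∸ k) ^ suc k) + (m ∸ k) ^ suc k
    ≡⟨ step (k ≤? m) ⟩
  (suc m ∸ k) ^ suc (suc k) ∸ (m ∸ k) ^ suc (suc k) ∎
  where
  open ≡-Reasoning
  step : Dec (k ≤ m) → (suc m ∸ k) * ((suc m ∸ k) ^ suc k ∸ (m ∸ k) ^ suc k) + (m ∸ k) ^ suc k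
                       ≡ (suc m ∸ k) ^ suc (suc k) ∸ (m ∸ k) ^ suc (suc k)
  step (yes k≤m) rewrite +-∸-assoc 1 k≤m = pow-diff-step (m ∸ k) (suc k)
  step (no k≰m)  rewrite m≤n⇒m∸n≡0 (≰⇒> k≰m) | m≤n⇒m∸n≡0 (<⇒≤ (≰⇒> k≰m)) = refl

mainTheorem10 : (n k : ℕ) → 1 ≤ k → k ≤ n →
    length (T n k) ≡ (n + 1 ∸ k) ^ k ∸ (n ∸ k) ^ k
mainTheorem10 n       zero    ()
mainTheorem10 zero    (suc k) _ ()
mainTheorem10 (suc m) (suc k) _ _ rewrite +-comm m 1 = T-closed m k
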